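{- Let $i\geq 1$ and $0\leq j\leq i$ be integers and let $G\in\mathcal{F}_{i,j}$. Then for every edge $e\in E(G)$, $$\phi(G-e)\leq \frac{2|E(G)|-|V(G)|+2}{7}+\max\left\{\frac{5-i}{7},0\right\}-1.$$
   Context: Graphs here may be multigraphs (loops and parallel edges allowed); a loop and a pair of parallel edges count as cycles. A feedback vertex set of $G$ is a set $S\subseteq V(G)$ such that $G-S$ has no cycle; $\phi(G)$ is its minimum size. For a multigraph $G$, edges $e_1,e_2\in E(G)$ (not necessarily distinct) and a vertex $a$ of degree two, $G\circ(e_1,e_2,a)$ is the multigraph obtained from $G$ by subdividing $e_1$ and $e_2$ once each (if $e_1=e_2$ this edge is subdivided twice) and adding a new vertex adjacent to $a$ and to the two new subdivision vertices. Define $\mathcal{F}_{1,0}$ to consist of the multigraph on one vertex with one loop, and $\mathcal{F}_{i,j}=\emptyset$ if $i\leq 0$ or $j<0$. For $0\leq j\leq i$ (other than $(i,j)=(1,0)$), $\mathcal{F}_{i,j}$ is the set of subcubic multigraphs (every vertex of degree at most three, loops counting twice) obtained either from a member of $\mathcal{F}_{i-1,j}$ by subdividing one edge once, or from a member of $\mathcal{F}_{i,j-1}$ by an operation $\circ$. -}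

module Defs where

open import Data.Nat using (ℕ; zero; suc; _+_; _≤_)
open import Data.Bool using (Bool; true; false; if_then_else_)
open import Data.Fin using (Fin; zero; suc; inject₁; fromℕ; _≟_)
open import Data.Fin.Subset using (Subset; outside)
open import Data.Vec using (lookup)
open import Data.List using (List; map; allFin)
open import Data.Nat.ListAction using (sum)
open import Data.Product using (Σ; _×_; _,_; proj₁; proj₂; ∃)
open import Data.Sum using (_⊎_)
open import Relation.Binary.PropositionalEquality using (_≡_)
open import Relation.Nullary using (¬_)
open import Relation.Nullary.Decidable using (⌊_⌋; False)
open import Function.Definitions using (Injective)
open import Function.Bundles using (_↔_; Inverse)

-- General multigraphs: abstract vertex and edge types, each edge has an
-- (ordered representation of its unordered) pair of ends; a loop has
-- both ends equal.

record Graph : Set₁ where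
  field
    V    : Set
    E    : Set
    ends : E → V × V
open Graph public

Joins : (G : Graph) → E G → V G → V G → Set
Joins G f x y = ends G f ≡ (x , y) ⊎ ends G f ≡ (y , x)

-- A cycle of length k+1 ≥ 1: distinct vertices v₀…v_k and distinct
-- edges e₀…e_k with e_t joining v_t and v_{t+1} (indices mod k+1).
-- Length 1 = loop, length 2 = pair of parallel edges.
record Cycle (G : Graph) : Set where
  field
    k     : ℕ
    vs    : Fin (suc k) → V G
    es    : Fin (suc k) → E G
    vsInj : Injective _≡_ _≡_ vs
    esInj : Injective _≡_ _≡_ es
    step  : (t : Fin k) → Joins G (es (inject₁ t)) (vs (inject₁ t)) (vs (suc t))
    close : Joins G (es (fromℕ k)) (vs (fromℕ k)) (vs zero)

Acyclic : Graph → Set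
Acyclic G = ¬ Cycle G

-- G - S : delete the vertices marked true by `inS` and all incident edges
-- (membership conditions are Bool equalities, hence proof-irrelevant)
delVertices : (G : Graph) → (V G → Bool) → Graph
delVertices G inS = record
  { V    = Σ (V G) (λ v → inS v ≡ false)
  ; E    = Σ (E G) (λ f → inS (proj₁ (ends G f)) ≡ false × inS (proj₂ (ends G f)) ≡ false)
  ; ends = λ { (f , p , q) → ((proj₁ (ends G f) , p) , (proj₂ (ends G f) , q)) }
  }

record MG : Set where
  constructor mg
  field
    n    : ℕ
    m    : ℕ
    edge : Fin m → Fin n × Fin n
open MG public

toGraph : MG → Graph
toGraph G = record { V = Fin (n G) ; E = Fin (m G) ; ends = edge G }

delEdge : (G : MG) → Fin (m G) → Graph
delEdge G e = record
  { V    = Fin (n G)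
  ; E    = Σ (Fin (m G)) (λ f → False (f ≟ e))
  ; ends = λ fp → edge G (proj₁ fp)
  }

delEdgeVertices : (G : MG) → Fin (m G) → Subset (n G) → Graph
delEdgeVertices G e S = delVertices (delEdge G e) (λ v → lookup S v)

-- degree (a loop counts twice)
ind : Bool → ℕ
ind b = if b then 1 else 0

deg : (G : MG) → Fin (n G) → ℕ
deg G v = sum (map (λ f → ind ⌊ proj₁ (edge G f) ≟ v ⌋ + ind ⌊ proj₂ (edge G f) ≟ v ⌋)
                   (allFin (m G)))

Subcubic : MG → Set
Subcubic G = (v : Fin (n G)) → deg G v ≤ 3

record _≅_ (G H : MG) : Set where
  field
    σ    : Fin (n G) ↔ Fin (n H)
    τ    : Fin (m G) ↔ Fin (m H)
    pres : (f : Fin (m G)) →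
           Joins (toGraph H) (Inverse.to τ f)
                 (Inverse.to σ (proj₁ (edge G f))) (Inverse.to σ (proj₂ (edge G f)))

loop1 : MG
loop1 = mg 1 1 (λ _ → (zero , zero))

-- subdivide edge e = (u,v) once: new vertex is `zero` (old vertices shifted
-- by suc); edge e becomes (u,new) (index suc e), new edge (new,v) (index zero)
subdiv : (G : MG) → Fin (m G) → MG
subdiv G e = mg (suc (n G)) (suc (m G)) ed
  where
  ed : Fin (suc (m G)) → Fin (suc (n G)) × Fin (suc (n G))
  ed zero    = (zero , suc (proj₂ (edge G e)))
  ed (suc f) = if ⌊ f ≟ e ⌋ then (suc (proj₁ (edge G e)) , zero)
               else (suc (proj₁ (edge G f)) , suc (proj₂ (edge G f)))

addClaw : (G : MG) → Fin (n G) → Fin (n G) → Fin (n G) → MG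
addClaw G a b c = mg (suc (n G)) (suc (suc (suc (m G)))) ed
  where
  ed : Fin (suc (suc (suc (m G)))) → Fin (suc (n G)) × Fin (suc (n G))
  ed zero                   = (zero , suc a)
  ed (suc zero)             = (zero , suc b)
  ed (suc (suc zero))       = (zero , suc c)
  ed (suc (suc (suc f)))    = (suc (proj₁ (edge G f)) , suc (proj₂ (edge G f)))

-- G ∘ (e₁,e₂,a): subdivide e₁ (new vertex x), then subdivide e₂ (new vertex
-- y; if e₂ = e₁ this subdivides the half u–x of e₁ again), then add a new
-- vertex adjacent to a, x, y.
circ : (G : MG) → Fin (m G) → Fin (m G) → Fin (n G) → MG
circ G e₁ e₂ a = addClaw G₂ (suc (suc a)) (suc zero) zero
  where
  G₁ = subdiv G e₁
  G₂ = subdiv G₁ (suc e₂)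

data 𝓕 : ℕ → ℕ → MG → Set where
  base : 𝓕 1 0 loop1
  sub  : ∀ {i j G} → 𝓕 i j G → (e : Fin (m G)) →
         Subcubic (subdiv G e) → 𝓕 (suc i) j (subdiv G e)
  op   : ∀ {i j G} → 𝓕 i j G → suc j ≤ i →
         (e₁ e₂ : Fin (m G)) (a : Fin (n G)) → deg G a ≡ 2 →
         Subcubic (circ G e₁ e₂ a) → 𝓕 i (suc j) (circ G e₁ e₂ a)
  iso  : ∀ {i j G H} → 𝓕 i j G → G ≅ H → 𝓕 i j H

-- Every G ∈ 𝓕 i j has i + 3j vertices and i + 5j edges, so the claimed bound follows from
-- φ(G − e) ≤ j (using only i + (5 ∸ i) ≥ 5). That bound holds for every edge e by induction:
-- a subdivision keeps the feedback vertex set of the corresponding edge, and an operation ∘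
-- adds the new claw centre to it; if e is itself a claw edge, one adds instead the subdivision
-- vertex x or y, reusing the set for G − e₁ or G − e₂, so that the centre becomes a leaf.
-- Acyclicity is certified by a ranking of the vertices in which every surviving edge is the
-- parent edge of its lower end: a vertex of minimum rank on a cycle would have two parents.
module Submission where

open import Defs
open import Data.Nat using (ℕ; zero; suc; _+_; _*_; _∸_; _≤_; _<_; s≤s; z≤n)
open import Data.Nat.Properties
  using (≤-refl; <-irrefl; <⇒≱; +-mono-<; +-mono-≤; +-monoˡ-≤; +-monoʳ-≤; *-monoʳ-≤; +-suc;
         m≤n+m∸n; n<1+n; ≤-totalOrder; +-0-commutativeMonoid; module ≤-Reasoning)
open import Data.Nat.Tactic.RingSolver using (solve-∀)
open import Data.Bool using (Bool; true; false; if_then_else_)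
import Data.Bool as Bool
open import Data.Bool.Properties using (T-irrelevant)
open import Data.Fin using (Fin; zero; suc; inject₁; fromℕ; _≟_; _↑ˡ_; _↑ʳ_)
import Data.Fin.Properties as Fin
open import Data.Fin.Permutation using (↔⇒≡)
open import Data.Fin.Relation.Unary.Top using (view; ‵fromℕ; ‵inject₁)
open import Data.Fin.Subset using (Subset; ∣_∣; inside; outside)
open import Data.Vec using ([]; _∷_; lookup; tabulate)
open import Data.Vec.Properties using (lookup∘tabulate)
import Data.Vec.Functional as Vector
open import Data.List using (allFin)
open import Data.List.Extrema ≤-totalOrder using (argmin; f[argmin]≤f[xs])
open import Data.List.Membership.Propositional.Properties using (∈-allFin)
import Data.List.Relation.Unary.All as All
open import Data.Maybe using (Maybe; just; nothing) renaming (map to mapMaybe)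
open import Data.Maybe.Properties using (just-injective)
open import Data.Product using (Σ; ∃; ∃₂; _×_; _,_; proj₁; proj₂)
import Data.Product as Product
open import Data.Sum using (_⊎_; inj₁; inj₂; swap)
import Data.Sum as Sum
open import Data.Empty using (⊥-elim)
open import Relation.Nullary using (Dec; yes; no)
open import Relation.Nullary.Decidable using (⌊_⌋; toWitnessFalse; ¬?; _×-dec_)
open import Relation.Binary.PropositionalEquality
open import Function using (_∘_)
open import Function.Definitions using (Injective)
open import Function.Bundles using (_↔_; Inverse)
open import Function.Construct.Symmetry using (↔-sym)
open import Axiom.UniquenessOfIdentityProofs using (module Decidable⇒UIP)
open import Algebra.Properties.CommutativeMonoid.Sum +-0-commutativeMonoid
  using (sum; sum-permute; sum-cong-≗)

ParentOfLowerEnd : {V L : Set} → (V → ℕ) → (V → Maybe L) → L → V × V → Set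
ParentOfLowerEnd rank parent l (x , y) =
  (rank x < rank y × parent x ≡ just l) ⊎ (rank y < rank x × parent y ≡ just l)

ParentOfLowerEnd-map : ∀ {V V′ L L′ : Set} {rank : V → ℕ} {parent : V → Maybe L}
  {rank′ : V′ → ℕ} {parent′ : V′ → Maybe L′} (φ : V → V′) (ψ : L → L′) →
  (∀ {x y} → rank x < rank y → rank′ (φ x) < rank′ (φ y)) →
  (∀ x → parent′ (φ x) ≡ mapMaybe ψ (parent x)) →
  ∀ {l x y} → ParentOfLowerEnd rank parent l (x , y) →
  ParentOfLowerEnd rank′ parent′ (ψ l) (φ x , φ y)
ParentOfLowerEnd-map φ ψ mono parent-φ {x = x} {y} =
  Sum.map (Product.map mono λ eq → trans (parent-φ x) (cong (mapMaybe ψ) eq))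
          (Product.map mono λ eq → trans (parent-φ y) (cong (mapMaybe ψ) eq))

module _ (G : Graph) {L : Set} (label : E G → L) (label-injective : Injective _≡_ _≡_ label)
         (rank : V G → ℕ) (parent : V G → Maybe L)
         (hangs : ∀ f → ParentOfLowerEnd rank parent (label f) (ends G f)) where

  parent-of-lower-end : ∀ {f x y} → Joins G f x y → rank x ≤ rank y →
                        rank x < rank y × parent x ≡ just (label f)
  parent-of-lower-end {f} joins x≤y with hangs f | joins
  ... | inj₁ x-below   | inj₁ refl = x-below
  ... | inj₂ x-below   | inj₂ refl = x-below
  ... | inj₁ (y<x , _) | inj₂ refl = ⊥-elim (<⇒≱ y<x x≤y)
  ... | inj₂ (y<x , _) | inj₁ refl = ⊥-elim (<⇒≱ y<x x≤y)

  ranked⇒acyclic : Acyclic G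
  ranked⇒acyclic record { k = zero ; es = es ; close = close } =
    <-irrefl refl (proj₁ (parent-of-lower-end close ≤-refl))
  ranked⇒acyclic record { k = suc k ; vs = vs ; es = es ; esInj = esInj ; step = step ; close = close } =
    arriving≢t₀ (sym (esInj (label-injective (just-injective (trans (sym parent-leaving) parent-arriving)))))
    where
    r : Fin (suc (suc k)) → ℕ
    r t = rank (vs t)
    t₀ = argmin r zero (allFin _)
    minimal : ∀ t → r t₀ ≤ r t
    minimal t = All.lookup (f[argmin]≤f[xs] {f = r} zero (allFin _)) (∈-allFin t)
    leaving : ∀ t → ∃ λ u → Joins G (es t) (vs t) (vs u)
    leaving t with view t
    ... | ‵fromℕ = zero , close
    ... | ‵inject₁ t = suc t , step t
    arriving : ∀ t → ∃₂ λ s u → s ≢ t × Joins G (es s) (vs t) (vs u)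
    arriving zero = fromℕ (suc k) , fromℕ (suc k) , (λ ()) , swap close
    arriving (suc t) = inject₁ t , inject₁ t , Fin.<⇒≢ (Fin.≤̄⇒inject₁< (Fin.≤-refl {x = t})) , swap (step t)
    s = proj₁ (arriving t₀)
    arriving≢t₀ : s ≢ t₀
    arriving≢t₀ = proj₁ (proj₂ (proj₂ (arriving t₀)))
    parent-leaving : parent (vs t₀) ≡ just (label (es t₀))
    parent-leaving = proj₂ (parent-of-lower-end (proj₂ (leaving t₀)) (minimal _))
    parent-arriving : parent (vs t₀) ≡ just (label (es s))
    parent-arriving = proj₂ (parent-of-lower-end (proj₂ (proj₂ (proj₂ (arriving t₀)))) (minimal _))

record Ranking (G : MG) (A : Fin (m G) → Set) : Set where
  constructor ranking
  field
    rank   : Fin (n G) → ℕ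
    parent : Fin (n G) → Maybe (Fin (m G))
    hangs  : ∀ f → A f → ParentOfLowerEnd rank parent f (edge G f)

Avoids : ∀ {N} → Subset N → Fin N × Fin N → Set
Avoids S p = lookup S (proj₁ p) ≡ false × lookup S (proj₂ p) ≡ false

Alive : (G : MG) → Fin (m G) → Subset (n G) → Fin (m G) → Set
Alive G e S f = f ≢ e × Avoids S (edge G f)

alive? : (G : MG) (e : Fin (m G)) (S : Subset (n G)) → ∀ f → Dec (Alive G e S f)
alive? G e S f = ¬? (f ≟ e) ×-dec (lookup S (proj₁ (edge G f)) Bool.≟ false)
                            ×-dec (lookup S (proj₂ (edge G f)) Bool.≟ false)

ranking⇒acyclic : ∀ {G e S} → Ranking G (Alive G e S) → Acyclic (delEdgeVertices G e S)
ranking⇒acyclic {G} {e} {S} R =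
  ranked⇒acyclic (delEdgeVertices G e S) (proj₁ ∘ proj₁) label-injective
    (rank ∘ proj₁) (parent ∘ proj₁)
    (λ { ((f , f≢e) , avoids) → hangs f (toWitnessFalse f≢e , avoids) })
  where
  open Ranking R
  open Decidable⇒UIP Bool._≟_ using (≡-irrelevant)
  label-injective : Injective _≡_ _≡_ (proj₁ ∘ proj₁)
  label-injective {(f , p) , q₁ , q₂} {(.f , p′) , q₁′ , q₂′} refl
    rewrite T-irrelevant p p′ | ≡-irrelevant q₁ q₁′ | ≡-irrelevant q₂ q₂′ = refl

odd : ℕ → ℕ
odd x = suc (x + x)

odd-mono-< : ∀ {x y} → x < y → odd x < odd y
odd-mono-< x<y = s≤s (+-mono-< x<y x<y)

1+odd<odd : ∀ {x y} → x < y → suc (odd x) < odd y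
1+odd<odd {x} {y} x<y = s≤s (subst (_≤ y + y) (cong suc (+-suc x x)) (+-mono-≤ x<y x<y))

-- Old vertices move to odd ranks, which leaves room below them and between any two of them.
shift-ParentOfLowerEnd : ∀ {N M M′} {rank : Fin N → ℕ} {parent : Fin N → Maybe (Fin M)}
  (rank₀ : ℕ) (parent₀ : Maybe (Fin M′)) (relabel : Fin M → Fin M′) →
  ∀ {l x y} → ParentOfLowerEnd rank parent l (x , y) →
  ParentOfLowerEnd (rank₀ Vector.∷ odd ∘ rank) (parent₀ Vector.∷ mapMaybe relabel ∘ parent)
                   (relabel l) (suc x , suc y)
shift-ParentOfLowerEnd {N} {rank = rank} {parent} rank₀ parent₀ relabel =
  ParentOfLowerEnd-map {V = Fin N} {rank = rank} {parent}
    {rank₀ Vector.∷ odd ∘ rank} {parent₀ Vector.∷ mapMaybe relabel ∘ parent}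
    suc relabel odd-mono-< (λ _ → refl)

module _ (G : MG) (e₀ : Fin (m G)) where

  private
    u = proj₁ (edge G e₀)
    v = proj₂ (edge G e₀)

  subdiv-edge-old : ∀ {f} → f ≢ e₀ →
    edge (subdiv G e₀) (suc f) ≡ (suc (proj₁ (edge G f)) , suc (proj₂ (edge G f)))
  subdiv-edge-old {f} f≢e₀ with f ≟ e₀
  ... | yes f≡e₀ = ⊥-elim (f≢e₀ f≡e₀)
  ... | no _ = refl

  subdiv-edge-e₀ : edge (subdiv G e₀) (suc e₀) ≡ (suc u , zero)
  subdiv-edge-e₀ with e₀ ≟ e₀
  ... | yes _ = refl
  ... | no e₀≢e₀ = ⊥-elim (e₀≢e₀ refl)

  -- the half h of e₀ inherits the role of e₀ as a parent edge
  inherit : Fin (suc (m G)) → Fin (m G) → Fin (suc (m G))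
  inherit h f = if ⌊ f ≟ e₀ ⌋ then h else suc f

  inherit-e₀ : ∀ {h} → inherit h e₀ ≡ h
  inherit-e₀ with e₀ ≟ e₀
  ... | yes _ = refl
  ... | no e₀≢e₀ = ⊥-elim (e₀≢e₀ refl)

  inherit-old : ∀ {h f} → f ≢ e₀ → inherit h f ≡ suc f
  inherit-old {f = f} f≢e₀ with f ≟ e₀
  ... | yes f≡e₀ = ⊥-elim (f≢e₀ f≡e₀)
  ... | no _ = refl

  module _ {A : Fin (m G) → Set} {A′ : Fin (suc (m G)) → Set} (R : Ranking G A)
           (old : ∀ f → f ≢ e₀ → A′ (suc f) → A f) where
    open Ranking R

    private
      extend : (h : Fin (suc (m G))) (rank₀ : ℕ) (parent₀ : Maybe (Fin (suc (m G)))) →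
        let rank′ = rank₀ Vector.∷ odd ∘ rank
            parent′ = parent₀ Vector.∷ mapMaybe (inherit h) ∘ parent in
        (A′ zero → ParentOfLowerEnd rank′ parent′ zero (zero , suc v)) →
        (A′ (suc e₀) → ParentOfLowerEnd rank′ parent′ (suc e₀) (suc u , zero)) →
        Ranking (subdiv G e₀) A′
      extend h rank₀ parent₀ half₀ half₁ = ranking rank′ parent′ hangs′
        where
        rank′ : Fin (suc (n G)) → ℕ
        rank′ = rank₀ Vector.∷ odd ∘ rank
        parent′ : Fin (suc (n G)) → Maybe (Fin (suc (m G)))
        parent′ = parent₀ Vector.∷ mapMaybe (inherit h) ∘ parent
        hangs′ : ∀ f → A′ f → ParentOfLowerEnd rank′ parent′ f (edge (subdiv G e₀) f)
        hangs′ zero a = half₀ a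
        hangs′ (suc f) a with f ≟ e₀
        ... | yes refl = half₁ a
        ... | no f≢e₀ =
          subst (λ l → ParentOfLowerEnd rank′ parent′ l (suc (proj₁ (edge G f)) , suc (proj₂ (edge G f))))
                (inherit-old f≢e₀)
                (shift-ParentOfLowerEnd {rank = rank} {parent} rank₀ parent₀ (inherit h)
                   (hangs f (old f f≢e₀ a)))

    -- If both halves survive, the new vertex is ranked between the ends of e₀; otherwise it is a leaf.
    subdiv-ranking : (A′ zero → A′ (suc e₀) → A e₀) → Dec (A′ zero) → Dec (A′ (suc e₀)) →
                     Ranking (subdiv G e₀) A′
    subdiv-ranking both (yes a₀) (yes a₁) with hangs e₀ (both a₀ a₁)
    ... | inj₁ (u<v , parent-u) =
      extend (suc e₀) (suc (odd (rank u))) (just zero)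
        (λ _ → inj₁ (1+odd<odd u<v , refl))
        (λ _ → inj₁ (n<1+n _ , trans (cong (mapMaybe (inherit (suc e₀))) parent-u) (cong just inherit-e₀)))
    ... | inj₂ (v<u , parent-v) =
      extend zero (suc (odd (rank v))) (just (suc e₀))
        (λ _ → inj₂ (n<1+n _ , trans (cong (mapMaybe (inherit zero)) parent-v) (cong just inherit-e₀)))
        (λ _ → inj₂ (1+odd<odd v<u , refl))
    subdiv-ranking both (yes a₀) (no ¬a₁) =
      extend (suc e₀) 0 (just zero) (λ _ → inj₁ (s≤s z≤n , refl)) (⊥-elim ∘ ¬a₁)
    subdiv-ranking both (no ¬a₀) _ =
      extend (suc e₀) 0 (just (suc e₀)) (⊥-elim ∘ ¬a₀) (λ _ → inj₂ (s≤s z≤n , refl))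

  -- The edges of subdiv G e₀ that come from f: its copy suc f (for f = e₀ the half at u),
  -- and for f = e₀ also the half zero at v.
  data Descends : Fin (m G) → Fin (suc (m G)) → Set where
    copy : ∀ f → Descends f (suc f)
    half : Descends e₀ zero

  subdiv-alive-ranking : ∀ {f f′ S} → Descends f f′ → (b : Bool) →
    Ranking G (Alive G f S) → Ranking (subdiv G e₀) (Alive (subdiv G e₀) f′ (b ∷ S))
  subdiv-alive-ranking {f} {f′} {S} descends b R =
    subdiv-ranking R old both (alive? G′ f′ S′ zero) (alive? G′ f′ S′ (suc e₀))
    where
    G′ = subdiv G e₀
    S′ = b ∷ S
    old : ∀ g → g ≢ e₀ → Alive G′ f′ S′ (suc g) → Alive G f S g
    old g g≢e₀ (g′≢f′ , avoids) = g≢f descends , subst (Avoids S′) (subdiv-edge-old g≢e₀) avoids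
      where
      g≢f : Descends f f′ → g ≢ f
      g≢f (copy _) refl = g′≢f′ refl
      g≢f half refl = g≢e₀ refl
    both : Alive G′ f′ S′ zero → Alive G′ f′ S′ (suc e₀) → Alive G f S e₀
    both (zero≢f′ , _ , v∉S) (e₀′≢f′ , avoids) =
      e₀≢f descends , proj₁ (subst (Avoids S′) subdiv-edge-e₀ avoids) , v∉S
      where
      e₀≢f : Descends f f′ → e₀ ≢ f
      e₀≢f (copy _) refl = e₀′≢f′ refl
      e₀≢f half _ = zero≢f′ refl

φ-minus-edge-≤ : MG → ℕ → Set
φ-minus-edge-≤ G j = ∀ e → Σ (Subset (n G)) λ S → Ranking G (Alive G e S) × ∣ S ∣ ≤ j

subdiv-φ-minus-edge-≤ : ∀ {G j} (e₀ : Fin (m G)) → φ-minus-edge-≤ G j → φ-minus-edge-≤ (subdiv G e₀) j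
subdiv-φ-minus-edge-≤ e₀ φ≤ zero with φ≤ e₀
... | S , R , size = outside ∷ S , subdiv-alive-ranking _ e₀ half outside R , size
subdiv-φ-minus-edge-≤ e₀ φ≤ (suc f) with φ≤ f
... | S , R , size = outside ∷ S , subdiv-alive-ranking _ e₀ (copy f) outside R , size

addClaw-ranking : ∀ (H : MG) a b c {A : Fin (m H) → Set} {A′ : Fin (3 + m H) → Set} →
  Ranking H A → (parent₀ : Maybe (Fin (3 + m H))) →
  (∀ f → A′ (3 ↑ʳ f) → A f) → (∀ k → A′ (k ↑ˡ m H) → parent₀ ≡ just (k ↑ˡ m H)) →
  Ranking (addClaw H a b c) A′
addClaw-ranking H a b c {A′ = A′} R parent₀ old claw = ranking rank′ parent′ hangs′
  where
  open Ranking R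
  rank′ : Fin (suc (n H)) → ℕ
  rank′ = 0 Vector.∷ odd ∘ rank
  parent′ : Fin (suc (n H)) → Maybe (Fin (3 + m H))
  parent′ = parent₀ Vector.∷ mapMaybe (3 ↑ʳ_) ∘ parent
  hangs′ : ∀ f → A′ f → ParentOfLowerEnd rank′ parent′ f (edge (addClaw H a b c) f)
  hangs′ zero a = inj₁ (s≤s z≤n , claw zero a)
  hangs′ (suc zero) a = inj₁ (s≤s z≤n , claw (suc zero) a)
  hangs′ (suc (suc zero)) a = inj₁ (s≤s z≤n , claw (suc (suc zero)) a)
  hangs′ (suc (suc (suc f))) a =
    shift-ParentOfLowerEnd {rank = rank} {parent} 0 parent₀ (3 ↑ʳ_) (hangs f (old f a))

-- In subdiv (subdiv G e₁) (suc e₂) the vertex y subdividing e₂ is zero and the vertex x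
-- subdividing e₁ is suc zero; the claw edges 0, 1, 2 of circ G e₁ e₂ a go to a, x and y.
circ-φ-minus-edge-≤ : ∀ {G j} (e₁ e₂ : Fin (m G)) (a : Fin (n G)) →
  φ-minus-edge-≤ G j → φ-minus-edge-≤ (circ G e₁ e₂ a) (suc j)
circ-φ-minus-edge-≤ {G} {j} e₁ e₂ a φ≤ = φ′≤
  where
  G₂ = subdiv (subdiv G e₁) (suc e₂)
  G′ = circ G e₁ e₂ a

  without-x : (d : Fin (m G′)) (parent₀ : Maybe (Fin (m G′))) →
    (∀ {S} (k : Fin 3) → Alive G′ d (outside ∷ outside ∷ inside ∷ S) (k ↑ˡ m G₂) → parent₀ ≡ just (k ↑ˡ m G₂)) →
    Σ (Subset (n G′)) λ S → Ranking G′ (Alive G′ d S) × ∣ S ∣ ≤ suc j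
  without-x d parent₀ claw with φ≤ e₁
  ... | S , R , size =
    outside ∷ S₂ , addClaw-ranking G₂ _ _ _ R₂ parent₀ old claw , s≤s size
    where
    S₂ = outside ∷ inside ∷ S
    R₂ : Ranking G₂ (Alive G₂ (suc zero) S₂)
    R₂ = subdiv-alive-ranking _ (suc e₂) (copy zero) outside (subdiv-alive-ranking G e₁ half inside R)
    old : ∀ g → Alive G′ d (outside ∷ S₂) (3 ↑ʳ g) → Alive G₂ (suc zero) S₂ g
    old zero (_ , avoids) = (λ ()) , avoids
    old (suc zero) (_ , () , _)
    old (suc (suc g)) (_ , avoids) = (λ ()) , avoids

  without-y : Σ (Subset (n G′)) λ S → Ranking G′ (Alive G′ (suc zero) S) × ∣ S ∣ ≤ suc j
  without-y with φ≤ e₂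
  ... | S , R , size = outside ∷ S₂ , addClaw-ranking G₂ _ _ _ R₂ (just zero) old claw , s≤s size
    where
    S₂ = inside ∷ outside ∷ S
    R₂ : Ranking G₂ (Alive G₂ zero S₂)
    R₂ = subdiv-alive-ranking _ (suc e₂) half inside (subdiv-alive-ranking G e₁ (copy e₂) outside R)
    old : ∀ g → Alive G′ (suc zero) (outside ∷ S₂) (3 ↑ʳ g) → Alive G₂ zero S₂ g
    old zero (_ , () , _)
    old (suc g) (_ , avoids) = (λ ()) , avoids
    claw : (k : Fin 3) → Alive G′ (suc zero) (outside ∷ S₂) (k ↑ˡ m G₂) → just zero ≡ just (k ↑ˡ m G₂)
    claw zero _ = refl
    claw (suc zero) (x-edge≢x-edge , _) = ⊥-elim (x-edge≢x-edge refl)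
    claw (suc (suc zero)) (_ , _ , ())

  φ′≤ : φ-minus-edge-≤ G′ (suc j)
  φ′≤ zero = without-x zero (just (suc (suc zero))) λ
    { zero (a-edge≢a-edge , _) → ⊥-elim (a-edge≢a-edge refl)
    ; (suc zero) (_ , _ , ())
    ; (suc (suc zero)) _ → refl }
  φ′≤ (suc zero) = without-y
  φ′≤ (suc (suc zero)) = without-x (suc (suc zero)) (just zero) λ
    { zero _ → refl
    ; (suc zero) (_ , _ , ())
    ; (suc (suc zero)) (y-edge≢y-edge , _) → ⊥-elim (y-edge≢y-edge refl) }
  φ′≤ (suc (suc (suc f))) with subdiv-φ-minus-edge-≤ (suc e₂) (subdiv-φ-minus-edge-≤ e₁ φ≤) f
  ... | S , R , size = inside ∷ S , addClaw-ranking G₂ _ _ _ R nothing old centre-deleted , s≤s size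
    where
    old : ∀ g → Alive G′ (3 ↑ʳ f) (inside ∷ S) (3 ↑ʳ g) → Alive G₂ f S g
    old g (g′≢f′ , avoids) = (λ g≡f → g′≢f′ (cong (3 ↑ʳ_) g≡f)) , avoids
    centre-deleted : (k : Fin 3) → Alive G′ (3 ↑ʳ f) (inside ∷ S) (k ↑ˡ m G₂) → nothing ≡ just (k ↑ˡ m G₂)
    centre-deleted zero (_ , () , _)
    centre-deleted (suc zero) (_ , () , _)
    centre-deleted (suc (suc zero)) (_ , () , _)

∣∣≡sum-ind : ∀ {N} (S : Subset N) → ∣ S ∣ ≡ sum (ind ∘ lookup S)
∣∣≡sum-ind [] = refl
∣∣≡sum-ind (true ∷ S) = cong suc (∣∣≡sum-ind S)
∣∣≡sum-ind (false ∷ S) = ∣∣≡sum-ind S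

∣∣-permute : ∀ {N N′} (σ : Fin N ↔ Fin N′) (S : Subset N) →
  ∣ tabulate (lookup S ∘ Inverse.from σ) ∣ ≡ ∣ S ∣
∣∣-permute σ S = begin
  ∣ tabulate (lookup S ∘ Inverse.from σ) ∣                  ≡⟨ ∣∣≡sum-ind (tabulate (lookup S ∘ Inverse.from σ)) ⟩
  sum (ind ∘ lookup (tabulate (lookup S ∘ Inverse.from σ))) ≡⟨ sum-cong-≗ (cong ind ∘ lookup∘tabulate (lookup S ∘ Inverse.from σ)) ⟩
  sum (ind ∘ lookup S ∘ Inverse.from σ)                     ≡⟨ sum-permute (ind ∘ lookup S) (↔-sym σ) ⟨
  sum (ind ∘ lookup S)                                      ≡⟨ ∣∣≡sum-ind S ⟨
  ∣ S ∣                                                     ∎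
  where open ≡-Reasoning

module _ {G H : MG} (iso : G ≅ H) where
  open _≅_ iso
  open Inverse

  ≅-ranking : ∀ {e S} → Ranking G (Alive G (from τ e) S) →
              Ranking H (Alive H e (tabulate (lookup S ∘ from σ)))
  ≅-ranking {e} {S} R = ranking rank′ parent′ hangs′
    where
    open Ranking R
    S′ = tabulate (lookup S ∘ from σ)
    rank′ : Fin (n H) → ℕ
    rank′ = rank ∘ from σ
    parent′ : Fin (n H) → Maybe (Fin (m H))
    parent′ = mapMaybe (to τ) ∘ parent ∘ from σ
    lookup-S′ : ∀ x → lookup S′ (to σ x) ≡ lookup S x
    lookup-S′ x = trans (lookup∘tabulate (lookup S ∘ from σ) (to σ x)) (cong (lookup S) (strictlyInverseʳ σ x))
    hangs′ : ∀ g → Alive H e S′ g → ParentOfLowerEnd rank′ parent′ g (edge H g)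
    hangs′ g (g≢e , avoids) = transport (edge H g) (subst (λ g → Joins (toGraph H) g (to σ a) (to σ b)) to-f (pres f)) avoids
      where
      f = from τ g
      a = proj₁ (edge G f)
      b = proj₂ (edge G f)
      to-f : to τ f ≡ g
      to-f = strictlyInverseˡ τ g
      f≢e : f ≢ from τ e
      f≢e f≡e = g≢e (trans (sym to-f) (trans (cong (to τ) f≡e) (strictlyInverseˡ τ e)))
      from-G : Avoids S′ (to σ a , to σ b) → ParentOfLowerEnd rank′ parent′ g (to σ a , to σ b)
      from-G (a∉S′ , b∉S′) =
        subst (λ l → ParentOfLowerEnd rank′ parent′ l (to σ a , to σ b)) to-f
          (ParentOfLowerEnd-map {rank = rank} {parent} {rank′} {parent′} (to σ) (to τ)
             (subst₂ _<_ (sym (cong rank (strictlyInverseʳ σ _))) (sym (cong rank (strictlyInverseʳ σ _))))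
             (λ x → cong (mapMaybe (to τ) ∘ parent) (strictlyInverseʳ σ x))
             (hangs f (f≢e , trans (sym (lookup-S′ a)) a∉S′ , trans (sym (lookup-S′ b)) b∉S′)))
      transport : ∀ p → p ≡ (to σ a , to σ b) ⊎ p ≡ (to σ b , to σ a) →
                  Avoids S′ p → ParentOfLowerEnd rank′ parent′ g p
      transport _ (inj₁ refl) = from-G
      transport _ (inj₂ refl) = swap ∘ from-G ∘ Product.swap

  ≅-φ-minus-edge-≤ : ∀ {j} → φ-minus-edge-≤ G j → φ-minus-edge-≤ H j
  ≅-φ-minus-edge-≤ {j} φ≤ e with φ≤ (from τ e)
  ... | S , R , size = tabulate (lookup S ∘ from σ) , ≅-ranking {S = S} R , subst (_≤ j) (sym (∣∣-permute σ S)) size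

𝓕⇒φ-minus-edge-≤ : ∀ {i j G} → 𝓕 i j G → φ-minus-edge-≤ G j
𝓕⇒φ-minus-edge-≤ base zero =
  outside ∷ [] , ranking (λ _ → 0) (λ _ → nothing) (λ { zero (loop≢loop , _) → ⊥-elim (loop≢loop refl) }) , z≤n
𝓕⇒φ-minus-edge-≤ (sub G∈𝓕 e _) = subdiv-φ-minus-edge-≤ e (𝓕⇒φ-minus-edge-≤ G∈𝓕)
𝓕⇒φ-minus-edge-≤ (op G∈𝓕 _ e₁ e₂ a _ _) = circ-φ-minus-edge-≤ e₁ e₂ a (𝓕⇒φ-minus-edge-≤ G∈𝓕)
𝓕⇒φ-minus-edge-≤ (iso G∈𝓕 G≅H) = ≅-φ-minus-edge-≤ G≅H (𝓕⇒φ-minus-edge-≤ G∈𝓕)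

c+[i+c*j]≡i+c*[1+j] : ∀ c i j → c + (i + c * j) ≡ i + c * suc j
c+[i+c*j]≡i+c*[1+j] = solve-∀

𝓕-order-size : ∀ {i j G} → 𝓕 i j G → n G ≡ i + 3 * j × m G ≡ i + 5 * j
𝓕-order-size base = refl , refl
𝓕-order-size (sub G∈𝓕 _ _) = Product.map (cong suc) (cong suc) (𝓕-order-size G∈𝓕)
𝓕-order-size {i} {suc j} (op G∈𝓕 _ _ _ _ _ _) =
  Product.map (λ n≡ → trans (cong (3 +_) n≡) (c+[i+c*j]≡i+c*[1+j] 3 i j))
              (λ m≡ → trans (cong (5 +_) m≡) (c+[i+c*j]≡i+c*[1+j] 5 i j))
              (𝓕-order-size G∈𝓕)
𝓕-order-size (iso G∈𝓕 G≅H) =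
  Product.map (trans (sym (↔⇒≡ (_≅_.σ G≅H)))) (trans (sym (↔⇒≡ (_≅_.τ G≅H)))) (𝓕-order-size G∈𝓕)

bound-from-order-size : ∀ i j s → s ≤ j → 7 * s + (i + 3 * j) + 7 ≤ 2 * (i + 5 * j) + 2 + (5 ∸ i)
bound-from-order-size i j s s≤j = begin
  7 * s + (i + 3 * j) + 7          ≤⟨ +-monoˡ-≤ 7 (+-monoˡ-≤ (i + 3 * j) (*-monoʳ-≤ 7 s≤j)) ⟩
  7 * j + (i + 3 * j) + 7          ≡⟨ regroup i j ⟩
  (i + 10 * j + 2) + 5             ≤⟨ +-monoʳ-≤ (i + 10 * j + 2) (m≤n+m∸n 5 i) ⟩
  (i + 10 * j + 2) + (i + (5 ∸ i)) ≡⟨ regroup′ i j (5 ∸ i) ⟩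
  2 * (i + 5 * j) + 2 + (5 ∸ i)    ∎
  where
  open ≤-Reasoning
  regroup : ∀ i j → 7 * j + (i + 3 * j) + 7 ≡ (i + 10 * j + 2) + 5
  regroup = solve-∀
  regroup′ : ∀ i j x → (i + 10 * j + 2) + (i + x) ≡ 2 * (i + 5 * j) + 2 + x
  regroup′ = solve-∀

lemma3p4 : (i j : ℕ) → 1 ≤ i → j ≤ i → (G : MG) → 𝓕 i j G →
    (e : Fin (m G)) →
    Σ (Subset (n G)) (λ S → Acyclic (delEdgeVertices G e S) ×
      (7 * ∣ S ∣ + n G + 7 ≤ 2 * m G + 2 + (5 ∸ i)))
lemma3p4 i j _ _ G G∈𝓕 e with 𝓕-order-size G∈𝓕 | 𝓕⇒φ-minus-edge-≤ G∈𝓕 e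
... | n≡ , m≡ | S , R , ∣S∣≤j =
  S , ranking⇒acyclic {S = S} R ,
  subst₂ (λ n m → 7 * ∣ S ∣ + n + 7 ≤ 2 * m + 2 + (5 ∸ i)) (sym n≡) (sym m≡)
         (bound-from-order-size i j ∣ S ∣ ∣S∣≤j)
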